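{- For every $n\ge 0$, $$\mathrm{RS}_n(111,1212)=\sum_{P\in\mathcal{M}_n}q^{l(P)}.$$
   Context: A restricted growth function (RGF) of length $n$ is a sequence $w=w_1\dots w_n$ of positive integers with $w_1=1$ and $w_i\le 1+\max\{w_1,\dots,w_{i-1}\}$ for $i\ge 2$; $R_0$ consists of the empty word and $R_n$ is the set of RGFs of length $n$. The standardization of a word replaces every occurrence of its smallest letter by $1$, of its next smallest letter by $2$, and so on. An RGF $w$ contains an RGF $v$ if some subword (subsequence, not necessarily consecutive) of $w$ standardizes to $v$; otherwise $w$ avoids $v$. $R_n(v_1,v_2)$ is the set of $w\in R_n$ avoiding both $v_1$ and $v_2$. For a word $w$ and position $j$, $\mathrm{rs}(w_j)$ is the number of distinct values $w_i$ with $i>j$ and $w_i<w_j$, $\mathrm{rs}(w)=\sum_j\mathrm{rs}(w_j)$, and $\mathrm{RS}_n(v_1,v_2)=\sum_{w\in R_n(v_1,v_2)}q^{\mathrm{rs}(w)}$. A Motzkin path of length $n$ is a lattice path from $(0,0)$ to $(n,0)$ staying weakly above the $x$-axis with steps up $(1,1)$, horizontal $(1,0)$ and down $(1,-1)$; $\mathcal{M}_n$ is the set of such paths. For a step $s_i$, its level $l(s_i)$ is the smaller of the $y$-coordinates of its two endpoints; for $P=s_1\dots s_n$, $l(P)=\sum_{i=1}^n l(s_i)$. -}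

module Defs where

open import Data.Nat using (ℕ; zero; suc; _+_; _∸_; _<ᵇ_; _≡ᵇ_; _⊔_)
open import Data.Bool using (Bool; true; false; _∧_; _∨_; not; if_then_else_)
open import Data.List using (List; []; _∷_; map; concatMap; length; _++_)

-- Words are lists of natural numbers (letters are positive integers).
Word : Set
Word = List ℕ

keep : {A : Set} → (A → Bool) → List A → List A
keep p [] = []
keep p (x ∷ xs) = if p x then x ∷ keep p xs else keep p xs

anyᵇ : {A : Set} → (A → Bool) → List A → Bool
anyᵇ p [] = false
anyᵇ p (x ∷ xs) = p x ∨ anyᵇ p xs

memᵇ : ℕ → List ℕ → Bool
memᵇ x = anyᵇ (λ y → x ≡ᵇ y)

eqWordᵇ : Word → Word → Bool
eqWordᵇ [] [] = true
eqWordᵇ (x ∷ xs) (y ∷ ys) = (x ≡ᵇ y) ∧ eqWordᵇ xs ys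
eqWordᵇ _ _ = false

distinct : List ℕ → List ℕ
distinct [] = []
distinct (x ∷ xs) = if memᵇ x xs then distinct xs else x ∷ distinct xs

oneTo : ℕ → List ℕ
oneTo zero = []
oneTo (suc m) = oneTo m ++ (suc m ∷ [])

allWords : ℕ → ℕ → List Word
allWords zero m = [] ∷ []
allWords (suc n) m = concatMap (λ a → map (a ∷_) (allWords n m)) (oneTo m)

-- RGF condition: w₁ = 1 and wᵢ ≤ 1 + max{w₁,…,w_{i-1}}, all letters positive.
-- rgfFrom mx w : w continues a prefix whose maximum is mx.
rgfFrom : ℕ → Word → Bool
rgfFrom mx [] = true
rgfFrom mx (x ∷ xs) = (0 <ᵇ x) ∧ (x <ᵇ suc (suc mx)) ∧ rgfFrom (mx ⊔ x) xs

isRGF : Word → Bool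
isRGF [] = true
isRGF (x ∷ xs) = (x ≡ᵇ 1) ∧ rgfFrom x xs

-- R n : the set of RGFs of length n (every letter of such a word is ≤ n).
R : ℕ → List Word
R n = keep isRGF (allWords n n)

subwords : Word → List Word
subwords [] = [] ∷ []
subwords (x ∷ xs) = map (x ∷_) (subwords xs) ++ subwords xs

standardize : Word → Word
standardize w = map (λ a → suc (length (distinct (keep (λ b → b <ᵇ a) w)))) w

contains : Word → Word → Bool
contains w v = anyᵇ (λ u → eqWordᵇ (standardize u) v) (subwords w)

avoids : Word → Word → Bool
avoids w v = not (contains w v)

Ravoid : ℕ → Word → Word → List Word
Ravoid n v₁ v₂ = keep (λ w → avoids w v₁ ∧ avoids w v₂) (R n)

rs : Word → ℕ
rs [] = 0
rs (x ∷ xs) = length (distinct (keep (λ b → b <ᵇ x) xs)) + rs xs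

data Step : Set where
  U H D : Step

allPaths : ℕ → List (List Step)
allPaths zero = [] ∷ []
allPaths (suc n) = concatMap (λ s → map (s ∷_) (allPaths n)) (U ∷ H ∷ D ∷ [])

validFrom : ℕ → List Step → Bool
validFrom y [] = y ≡ᵇ 0
validFrom y (U ∷ p) = validFrom (suc y) p
validFrom y (H ∷ p) = validFrom y p
validFrom zero (D ∷ p) = false
validFrom (suc y) (D ∷ p) = validFrom y p

M : ℕ → List (List Step)
M n = keep (validFrom 0) (allPaths n)

-- total level of a path starting at height y (level of a step = lower endpoint height)
levelFrom : ℕ → List Step → ℕ
levelFrom y [] = 0
levelFrom y (U ∷ p) = y + levelFrom (suc y) p
levelFrom y (H ∷ p) = y + levelFrom y p
levelFrom y (D ∷ p) = (y ∸ 1) + levelFrom (y ∸ 1) p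

level : List Step → ℕ
level = levelFrom 0

-- Generating polynomial Σ_{x ∈ xs} q^{f x}, represented by its coefficient
-- function: coefficient of q^k = number of x in xs with f x = k.
genPoly : {A : Set} → List A → (A → ℕ) → ℕ → ℕ
genPoly xs f k = length (keep (λ x → f x ≡ᵇ k) xs)

RS : ℕ → Word → Word → ℕ → ℕ
RS n v₁ v₂ = genPoly (Ravoid n v₁ v₂) rs

module Submission where

-- Avoiding 111 says that every block of the set partition encoded by the RGF has at most two
-- elements, and avoiding 1212 that no two of the two-element blocks cross.  Read such a word from
-- left to right: a letter opening a two-element block is an up step, a singleton block a horizontal
-- step, and the second letter of a block a down step.  Non-crossing forces the block being closed
-- to be the most recently opened one still open, so the open letters form a stack whose size is
-- the height of the path, and this is a bijection onto Motzkin paths.  When a letter is written,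
-- the smaller letters still to come are exactly the open letters below it, so its rs-value is the
-- level of the corresponding step.

open import Defs
open import Data.Bool using (Bool; true; false; T; not)
open import Data.Bool.Properties using (T-∧; T-∨; T-≡)
open import Data.Empty using (⊥; ⊥-elim)
open import Data.List using (List; []; _∷_; [_]; map; length; _++_; filterᵇ; cartesianProductWith; concatMap)
open import Data.List.Properties using (length-map; map-∘; map-id-local; ∷-injective; ++-assoc)
open import Data.List.Membership.Propositional using (_∈_; _∉_; find)
open import Data.List.Membership.Propositional.Properties
  using (∈-filter⁺; ∈-filter⁻; ∈-map⁺; ∈-map⁻; ∈-++⁺ˡ; ∈-++⁺ʳ; ∈-++⁻; ∈-cartesianProductWith⁺; ∈-cartesianProductWith⁻)
open import Data.List.Membership.Propositional.Properties.WithK using (unique∧set⇒bag)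
open import Data.List.Relation.Binary.BagAndSetEquality using (∼bag⇒↭)
open import Data.List.Relation.Binary.Permutation.Propositional.Properties using (↭-length)
open import Data.List.Relation.Binary.Pointwise using (≡⇒Pointwise-≡; []; _∷_)
open import Data.List.Relation.Binary.Sublist.Propositional using (_⊆_; []; _∷_; _∷ʳ_; lookup; ⊆-refl; ⊆-trans; from∈)
open import Data.List.Relation.Binary.Sublist.Propositional.Properties using (++⁺; ++⁺ʳ)
open import Data.List.Relation.Unary.Any as Any using (Any; here; there)
import Data.List.Relation.Unary.All as All
open import Data.List.Relation.Unary.AllPairs as AllPairs using (AllPairs; []; _∷_)
open import Data.List.Relation.Unary.Unique.Propositional using (Unique)
import Data.List.Relation.Unary.Unique.Propositional.Properties as Unique
open import Data.Nat using (ℕ; zero; suc; _+_; _<ᵇ_; _≡ᵇ_; _⊔_; _≤_; _<_; _>_; z≤n; s≤s)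
open import Data.Nat.Properties
open import Data.List.Membership.DecPropositional _≟_ using (_∈?_)
open import Data.Product using (∃; _×_; _,_; proj₁; proj₂; map₁; map₂)
open import Data.Sum using (_⊎_; inj₁; inj₂; [_,_]′)
open import Function using (_∘_; flip; _⇔_; mk⇔; Equivalence)
open import Relation.Binary.Definitions using (Tri; tri<; tri≈; tri>)
open import Relation.Binary.PropositionalEquality using (_≡_; refl; sym; trans; cong; cong₂; subst; _≢_; module ≡-Reasoning)
open import Relation.Nullary using (¬_; yes; no; contradiction)
open import Relation.Nullary.Decidable using (T?)

module _ {A : Set} (p : A → Bool) where

  keep≡filterᵇ : ∀ xs → keep p xs ≡ filterᵇ p xs
  keep≡filterᵇ [] = refl
  keep≡filterᵇ (x ∷ xs) with p x
  ... | true  = cong (x ∷_) (keep≡filterᵇ xs)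
  ... | false = keep≡filterᵇ xs

  ∈-keep⁻ : ∀ {x} xs → x ∈ keep p xs → x ∈ xs × T (p x)
  ∈-keep⁻ xs x∈ = ∈-filter⁻ (T? ∘ p) (subst (_ ∈_) (keep≡filterᵇ xs) x∈)

  ∈-keep⁺ : ∀ {x} xs → x ∈ xs → T (p x) → x ∈ keep p xs
  ∈-keep⁺ xs x∈ px = subst (_ ∈_) (sym (keep≡filterᵇ xs)) (∈-filter⁺ (T? ∘ p) x∈ px)

  keep-unique : ∀ {xs} → Unique xs → Unique (keep p xs)
  keep-unique {xs} u = subst Unique (sym (keep≡filterᵇ xs)) (Unique.filter⁺ (T? ∘ p) u)

  anyᵇ⁺ : ∀ {xs} → Any (T ∘ p) xs → T (anyᵇ p xs)
  anyᵇ⁺ (here px) = Equivalence.from T-∨ (inj₁ px)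
  anyᵇ⁺ (there pxs) = Equivalence.from T-∨ (inj₂ (anyᵇ⁺ pxs))

  anyᵇ⁻ : ∀ xs → T (anyᵇ p xs) → Any (T ∘ p) xs
  anyᵇ⁻ (x ∷ xs) t with Equivalence.to T-∨ t
  ... | inj₁ px = here px
  ... | inj₂ pxs = there (anyᵇ⁻ xs pxs)

memᵇ⇒∈ : ∀ {x} xs → T (memᵇ x xs) → x ∈ xs
memᵇ⇒∈ xs t = Any.map (≡ᵇ⇒≡ _ _) (anyᵇ⁻ _ xs t)

∈⇒memᵇ : ∀ {x xs} → x ∈ xs → T (memᵇ x xs)
∈⇒memᵇ {x} x∈ = anyᵇ⁺ _ (Any.map (≡⇒≡ᵇ x _) x∈)

∈-distinct⇔ : ∀ {x} xs → x ∈ distinct xs ⇔ x ∈ xs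
∈-distinct⇔ xs = mk⇔ (to xs) (from xs)
  where
  to : ∀ {x} xs → x ∈ distinct xs → x ∈ xs
  to (y ∷ ys) x∈ with memᵇ y ys
  ... | true = there (to ys x∈)
  to (y ∷ ys) (here refl) | false = here refl
  to (y ∷ ys) (there x∈) | false = there (to ys x∈)
  from : ∀ {x} xs → x ∈ xs → x ∈ distinct xs
  from (y ∷ ys) x∈ with memᵇ y ys in eq
  from (y ∷ ys) (here refl) | true = from ys (memᵇ⇒∈ ys (Equivalence.from T-≡ eq))
  from (y ∷ ys) (there x∈) | true = from ys x∈
  from (y ∷ ys) (here refl) | false = here refl
  from (y ∷ ys) (there x∈) | false = there (from ys x∈)

distinct-unique : ∀ xs → Unique (distinct xs)
distinct-unique [] = []
distinct-unique (x ∷ xs) with memᵇ x xs in eq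
... | true = distinct-unique xs
... | false = All.tabulate x∉ ∷ distinct-unique xs
  where
  x∉ : ∀ {y} → y ∈ distinct xs → x ≢ y
  x∉ y∈ refl = subst T eq (∈⇒memᵇ (Equivalence.to (∈-distinct⇔ xs) y∈))

-- Counting through a bijection

unique∧set⇒length≡ : ∀ {A : Set} {xs ys : List A} → Unique xs → Unique ys →
                     (∀ {z} → z ∈ xs ⇔ z ∈ ys) → length xs ≡ length ys
unique∧set⇒length≡ uxs uys xs∼ys = ↭-length (∼bag⇒↭ (unique∧set⇒bag uxs uys xs∼ys))

module _ {A B : Set} {xs : List A} {ys : List B} (f : A → B) (g : B → A)
         (f∈ : ∀ {x} → x ∈ xs → f x ∈ ys) (g∈ : ∀ {y} → y ∈ ys → g y ∈ xs)
         (gf : ∀ {x} → x ∈ xs → g (f x) ≡ x) (fg : ∀ {y} → y ∈ ys → f (g y) ≡ y) where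

  length-≡-by-inverses : Unique xs → Unique ys → length xs ≡ length ys
  length-≡-by-inverses uxs uys = begin
    length xs         ≡⟨ sym (length-map f xs) ⟩
    length (map f xs) ≡⟨ unique∧set⇒length≡ uniq-fxs uys (mk⇔ to from) ⟩
    length ys         ∎
    where
    open ≡-Reasoning
    g∘f≡id : map g (map f xs) ≡ xs
    g∘f≡id = trans (sym (map-∘ xs)) (map-id-local (All.tabulate gf))
    uniq-fxs : Unique (map f xs)
    uniq-fxs = Unique.map⁻ (subst Unique (sym g∘f≡id) uxs)
    to : ∀ {y} → y ∈ map f xs → y ∈ ys
    to y∈ with _ , x∈ , refl ← ∈-map⁻ f y∈ = f∈ x∈
    from : ∀ {y} → y ∈ ys → y ∈ map f xs
    from y∈ = subst (_∈ map f xs) (fg y∈) (∈-map⁺ f (g∈ y∈))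

module _ {A B : Set} {xs : List A} {ys : List B} (stat₁ : A → ℕ) (stat₂ : B → ℕ) (f : A → B) (g : B → A)
         (f∈ : ∀ {x} → x ∈ xs → f x ∈ ys) (g∈ : ∀ {y} → y ∈ ys → g y ∈ xs)
         (gf : ∀ {x} → x ∈ xs → g (f x) ≡ x) (fg : ∀ {y} → y ∈ ys → f (g y) ≡ y)
         (f-stat : ∀ {x} → x ∈ xs → stat₂ (f x) ≡ stat₁ x) where

  genPoly-≡-by-inverses : Unique xs → Unique ys → ∀ k → genPoly xs stat₁ k ≡ genPoly ys stat₂ k
  genPoly-≡-by-inverses uxs uys k =
    length-≡-by-inverses f g f∈′ g∈′ (gf ∘ proj₁ ∘ from-xs) (fg ∘ proj₁ ∘ from-ys) (keep-unique _ uxs) (keep-unique _ uys)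
    where
    from-xs : ∀ {x} → x ∈ keep (λ x → stat₁ x ≡ᵇ k) xs → x ∈ xs × T (stat₁ x ≡ᵇ k)
    from-xs = ∈-keep⁻ _ xs
    from-ys : ∀ {y} → y ∈ keep (λ y → stat₂ y ≡ᵇ k) ys → y ∈ ys × T (stat₂ y ≡ᵇ k)
    from-ys = ∈-keep⁻ _ ys
    f∈′ : ∀ {x} → x ∈ keep (λ x → stat₁ x ≡ᵇ k) xs → f x ∈ keep (λ y → stat₂ y ≡ᵇ k) ys
    f∈′ x∈ with x∈xs , stat≡k ← from-xs x∈ =
      ∈-keep⁺ _ ys (f∈ x∈xs) (subst (λ s → T (s ≡ᵇ k)) (sym (f-stat x∈xs)) stat≡k)
    g∈′ : ∀ {y} → y ∈ keep (λ y → stat₂ y ≡ᵇ k) ys → g y ∈ keep (λ x → stat₁ x ≡ᵇ k) xs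
    g∈′ {y} y∈ with y∈ys , stat≡k ← from-ys y∈ =
      ∈-keep⁺ _ xs (g∈ y∈ys) (subst (λ s → T (s ≡ᵇ k)) (trans (cong stat₂ (sym (fg y∈ys))) (f-stat (g∈ y∈ys))) stat≡k)

concatMap-prepend≡cartesianProduct : ∀ {A : Set} (l : List A) (L : List (List A)) →
  concatMap (λ a → map (a ∷_) L) l ≡ cartesianProductWith _∷_ l L
concatMap-prepend≡cartesianProduct [] L = refl
concatMap-prepend≡cartesianProduct (a ∷ l) L = cong (map (a ∷_) L ++_) (concatMap-prepend≡cartesianProduct l L)

∈-oneTo⁺ : ∀ {m x} → 1 ≤ x → x ≤ m → x ∈ oneTo m
∈-oneTo⁺ {zero} 1≤x x≤0 = ⊥-elim (<⇒≱ 1≤x x≤0)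
∈-oneTo⁺ {suc m} {x} 1≤x x≤1+m with x ≤? m
... | yes x≤m = ∈-++⁺ˡ (∈-oneTo⁺ 1≤x x≤m)
... | no x≰m rewrite ≤-antisym x≤1+m (≰⇒> x≰m) = ∈-++⁺ʳ (oneTo m) (here refl)

∈-oneTo⁻ : ∀ m {x} → x ∈ oneTo m → 1 ≤ x × x ≤ m
∈-oneTo⁻ (suc m) x∈ with ∈-++⁻ (oneTo m) x∈
... | inj₁ x∈′ = map₂ m≤n⇒m≤1+n (∈-oneTo⁻ m x∈′)
... | inj₂ (here refl) = s≤s z≤n , ≤-refl

oneTo-unique : ∀ m → Unique (oneTo m)
oneTo-unique zero = []
oneTo-unique (suc m) = Unique.++⁺ (oneTo-unique m) (All.[] ∷ []) disjoint
  where
  disjoint : ∀ {x} → x ∈ oneTo m × x ∈ [ suc m ] → ⊥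
  disjoint (x∈ , here refl) = 1+n≰n (proj₂ (∈-oneTo⁻ m x∈))

allWords-length : ∀ n m {w} → w ∈ allWords n m → length w ≡ n
allWords-length zero m (here refl) = refl
allWords-length (suc n) m w∈
  with _ , _ , _ , w′∈ , refl ← ∈-cartesianProductWith⁻ _∷_ (oneTo m) (allWords n m)
                                   (subst (_ ∈_) (concatMap-prepend≡cartesianProduct (oneTo m) (allWords n m)) w∈)
  = cong suc (allWords-length n m w′∈)

∈-allWords : ∀ m w → (∀ {x} → x ∈ w → 1 ≤ x × x ≤ m) → w ∈ allWords (length w) m
∈-allWords m [] _ = here refl
∈-allWords m (x ∷ w) bounded =
  subst (x ∷ w ∈_) (sym (concatMap-prepend≡cartesianProduct (oneTo m) (allWords (length w) m)))
    (∈-cartesianProductWith⁺ _∷_ (∈-oneTo⁺ (proj₁ (bounded (here refl))) (proj₂ (bounded (here refl))))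
                                 (∈-allWords m w (bounded ∘ there)))

allWords-unique : ∀ n m → Unique (allWords n m)
allWords-unique zero m = All.[] ∷ []
allWords-unique (suc n) m =
  subst Unique (sym (concatMap-prepend≡cartesianProduct (oneTo m) (allWords n m)))
    (Unique.cartesianProductWith⁺ _∷_ ∷-injective (oneTo-unique m) (allWords-unique n m))

steps : List Step
steps = U ∷ H ∷ D ∷ []

allPaths-length : ∀ n {p} → p ∈ allPaths n → length p ≡ n
allPaths-length zero (here refl) = refl
allPaths-length (suc n) p∈
  with _ , _ , _ , p′∈ , refl ← ∈-cartesianProductWith⁻ _∷_ steps (allPaths n)
                                   (subst (_ ∈_) (concatMap-prepend≡cartesianProduct steps (allPaths n)) p∈)
  = cong suc (allPaths-length n p′∈)

∈-allPaths : ∀ p → p ∈ allPaths (length p)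
∈-allPaths [] = here refl
∈-allPaths (s ∷ p) =
  subst (s ∷ p ∈_) (sym (concatMap-prepend≡cartesianProduct steps (allPaths (length p))))
    (∈-cartesianProductWith⁺ _∷_ (∈-steps s) (∈-allPaths p))
  where
  ∈-steps : ∀ s → s ∈ steps
  ∈-steps U = here refl
  ∈-steps H = there (here refl)
  ∈-steps D = there (there (here refl))

allPaths-unique : ∀ n → Unique (allPaths n)
allPaths-unique zero = All.[] ∷ []
allPaths-unique (suc n) =
  subst Unique (sym (concatMap-prepend≡cartesianProduct steps (allPaths n)))
    (Unique.cartesianProductWith⁺ _∷_ ∷-injective steps-unique (allPaths-unique n))
  where
  steps-unique : Unique steps
  steps-unique = ((λ ()) All.∷ (λ ()) All.∷ All.[]) ∷ ((λ ()) All.∷ All.[]) ∷ All.[] ∷ []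

subwords⁻ : ∀ {u} w → u ∈ subwords w → u ⊆ w
subwords⁻ [] (here refl) = []
subwords⁻ (x ∷ w) u∈ with ∈-++⁻ (map (x ∷_) (subwords w)) u∈
... | inj₁ u∈′ with _ , u′∈ , refl ← ∈-map⁻ (x ∷_) u∈′ = refl ∷ subwords⁻ w u′∈
... | inj₂ u∈′ = x ∷ʳ subwords⁻ w u∈′

subwords⁺ : ∀ {u w} → u ⊆ w → u ∈ subwords w
subwords⁺ [] = here refl
subwords⁺ {w = y ∷ w} (y ∷ʳ u⊆w) = ∈-++⁺ʳ (map (y ∷_) (subwords w)) (subwords⁺ u⊆w)
subwords⁺ (refl ∷ u⊆w) = ∈-++⁺ˡ (∈-map⁺ (_ ∷_) (subwords⁺ u⊆w))

eqWordᵇ⇒≡ : ∀ u v → T (eqWordᵇ u v) → u ≡ v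
eqWordᵇ⇒≡ [] [] _ = refl
eqWordᵇ⇒≡ (x ∷ u) (y ∷ v) t with Equivalence.to T-∧ t
... | x≡ᵇy , u≡v = cong₂ _∷_ (≡ᵇ⇒≡ x y x≡ᵇy) (eqWordᵇ⇒≡ u v u≡v)

eqWordᵇ-refl : ∀ u → T (eqWordᵇ u u)
eqWordᵇ-refl [] = _
eqWordᵇ-refl (x ∷ u) = Equivalence.from T-∧ (≡⇒≡ᵇ x x refl , eqWordᵇ-refl u)

Avoids : Word → Word → Set
Avoids w v = ∀ {u} → u ⊆ w → standardize u ≢ v

avoids⇒Avoids : ∀ w v → T (avoids w v) → Avoids w v
avoids⇒Avoids w v t {u} u⊆w refl = subst (T ∘ not) contains-v t
  where
  contains-v : contains w v ≡ true
  contains-v = Equivalence.to T-≡ (anyᵇ⁺ _ (Any.map (λ { refl → eqWordᵇ-refl (standardize u) }) (subwords⁺ u⊆w)))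

Avoids⇒avoids : ∀ w v → Avoids w v → T (avoids w v)
Avoids⇒avoids w v w-avoids with contains w v in eq
... | false = _
... | true with _ , u∈ , std≡ ← find (anyᵇ⁻ _ (subwords w) (subst T (sym eq) _))
  = w-avoids (subwords⁻ w u∈) (eqWordᵇ⇒≡ _ _ std≡)

-- Standardization of 111 and 1212

countBelow : ℕ → Word → ℕ
countBelow c u = length (distinct (keep (_<ᵇ c) u))

countBelow≡length : ∀ {c u st} → Unique st →
  (∀ {z} → z ∈ u → z < c → z ∈ st) → (∀ {z} → z ∈ st → z ∈ u × z < c) →
  countBelow c u ≡ length st
countBelow≡length {c} {u} {st} ust below⇒st st⇒below =
  unique∧set⇒length≡ (distinct-unique (keep (_<ᵇ c) u)) ust (mk⇔ to from)
  where
  to : ∀ {z} → z ∈ distinct (keep (_<ᵇ c) u) → z ∈ st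
  to z∈ with z∈u , z<ᵇc ← ∈-keep⁻ (_<ᵇ c) u (Equivalence.to (∈-distinct⇔ (keep (_<ᵇ c) u)) z∈)
    = below⇒st z∈u (<ᵇ⇒< _ c z<ᵇc)
  from : ∀ {z} → z ∈ st → z ∈ distinct (keep (_<ᵇ c) u)
  from z∈ with z∈u , z<c ← st⇒below z∈
    = Equivalence.from (∈-distinct⇔ (keep (_<ᵇ c) u)) (∈-keep⁺ (_<ᵇ c) u z∈u (<⇒<ᵇ z<c))

countBelow-none : ∀ {c u} → (∀ {z} → z ∈ u → ¬ z < c) → countBelow c u ≡ 0
countBelow-none none = countBelow≡length [] (λ z∈ z<c → ⊥-elim (none z∈ z<c)) (λ ())

countBelow≡0⇒ : ∀ {c} u → countBelow c u ≡ 0 → ∀ {z} → z ∈ u → ¬ z < c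
countBelow≡0⇒ {c} u count≡0 z∈ z<c
  with distinct (keep (_<ᵇ c) u) | Equivalence.from (∈-distinct⇔ (keep (_<ᵇ c) u)) (∈-keep⁺ (_<ᵇ c) u z∈ (<⇒<ᵇ z<c))
... | [] | ()
... | _ ∷ _ | _ with () ← count≡0

NoTriple : Word → Set
NoTriple w = ∀ a → ¬ (a ∷ a ∷ a ∷ [] ⊆ w)

NoCrossing : Word → Set
NoCrossing w = ∀ {a b} → a < b → ¬ (a ∷ b ∷ a ∷ b ∷ [] ⊆ w)

standardize-aaa : ∀ a → standardize (a ∷ a ∷ a ∷ []) ≡ 1 ∷ 1 ∷ 1 ∷ []
standardize-aaa a = cong (λ k → suc k ∷ suc k ∷ suc k ∷ []) (countBelow-none a≮a)
  where
  a≮a : ∀ {z} → z ∈ a ∷ a ∷ a ∷ [] → ¬ z < a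
  a≮a (here refl) = n≮n a
  a≮a (there (here refl)) = n≮n a
  a≮a (there (there (here refl))) = n≮n a

standardize-abab : ∀ {a b} → a < b → standardize (a ∷ b ∷ a ∷ b ∷ []) ≡ 1 ∷ 2 ∷ 1 ∷ 2 ∷ []
standardize-abab {a} {b} a<b =
  cong₂ (λ k l → suc k ∷ suc l ∷ suc k ∷ suc l ∷ []) (countBelow-none ≮a) (countBelow≡length (All.[] ∷ []) below-b a-below-b)
  where
  ≮a : ∀ {z} → z ∈ a ∷ b ∷ a ∷ b ∷ [] → ¬ z < a
  ≮a (here refl) = n≮n a
  ≮a (there (here refl)) = <-asym a<b
  ≮a (there (there (here refl))) = n≮n a
  ≮a (there (there (there (here refl)))) = <-asym a<b
  below-b : ∀ {z} → z ∈ a ∷ b ∷ a ∷ b ∷ [] → z < b → z ∈ [ a ]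
  below-b (here refl) _ = here refl
  below-b (there (here refl)) b<b = ⊥-elim (n≮n b b<b)
  below-b (there (there (here refl))) _ = here refl
  below-b (there (there (there (here refl)))) b<b = ⊥-elim (n≮n b b<b)
  a-below-b : ∀ {z} → z ∈ [ a ] → z ∈ a ∷ b ∷ a ∷ b ∷ [] × z < b
  a-below-b (here refl) = here refl , a<b

standardize≡111⇒ : ∀ u → standardize u ≡ 1 ∷ 1 ∷ 1 ∷ [] → ∃ λ a → u ≡ a ∷ a ∷ a ∷ []
standardize≡111⇒ u@(a ∷ b ∷ c ∷ []) std≡ with ≡⇒Pointwise-≡ std≡
... | a₀ ∷ b₀ ∷ c₀ ∷ []
  with refl ← ≤∧≮⇒≡ (≮⇒≥ (countBelow≡0⇒ u (suc-injective a₀) (there (here refl))))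
                     (countBelow≡0⇒ u (suc-injective b₀) (here refl))
     | refl ← ≤∧≮⇒≡ (≮⇒≥ (countBelow≡0⇒ u (suc-injective a₀) (there (there (here refl)))))
                     (countBelow≡0⇒ u (suc-injective c₀) (here refl))
  = a , refl

standardize≡1212⇒ : ∀ u → standardize u ≡ 1 ∷ 2 ∷ 1 ∷ 2 ∷ [] →
                    ∃ λ a → ∃ λ b → a < b × u ≡ a ∷ b ∷ a ∷ b ∷ []
standardize≡1212⇒ u@(a ∷ b ∷ c ∷ d ∷ []) std≡ with ≡⇒Pointwise-≡ std≡
... | a₀ ∷ b₁ ∷ c₀ ∷ d₁ ∷ []
  with refl ← ≤∧≮⇒≡ (≮⇒≥ (countBelow≡0⇒ u (suc-injective a₀) (there (there (here refl)))))
                     (countBelow≡0⇒ u (suc-injective c₀) (here refl))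
  = b≡d (<-cmp b d)
  where
  a<b : a < b
  a<b = ≤∧≢⇒< (≮⇒≥ (countBelow≡0⇒ u (suc-injective a₀) (there (here refl))))
              (λ { refl → 0≢1+n (trans (sym (suc-injective a₀)) (suc-injective b₁)) })
  a<d : a < d
  a<d = ≤∧≢⇒< (≮⇒≥ (countBelow≡0⇒ u (suc-injective a₀) (there (there (there (here refl))))))
              (λ { refl → 0≢1+n (trans (sym (suc-injective a₀)) (suc-injective d₁)) })
  -- Two distinct letters lie below the larger of b and d, contradicting its standardized value 2.
  b≡d : Tri (b < d) (b ≡ d) (d < b) → ∃ λ a → ∃ λ b → a < b × u ≡ a ∷ b ∷ a ∷ b ∷ []
  b≡d (tri≈ _ refl _) = a , b , a<b , refl
  b≡d (tri< b<d _ _) = contradiction (trans (sym (suc-injective d₁)) two-below-d) λ ()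
    where
    below-d : ∀ {z} → z ∈ u → z < d → z ∈ a ∷ b ∷ []
    below-d (here refl) _ = here refl
    below-d (there (here refl)) _ = there (here refl)
    below-d (there (there (here refl))) _ = here refl
    below-d (there (there (there (here refl)))) d<d = ⊥-elim (n≮n d d<d)
    two-below-d : countBelow d u ≡ 2
    two-below-d = countBelow≡length ((<⇒≢ a<b All.∷ All.[]) ∷ All.[] ∷ []) below-d
      λ { (here refl) → here refl , a<d ; (there (here refl)) → there (here refl) , b<d }
  b≡d (tri> _ _ d<b) = contradiction (trans (sym (suc-injective b₁)) two-below-b) λ ()
    where
    below-b : ∀ {z} → z ∈ u → z < b → z ∈ a ∷ d ∷ []
    below-b (here refl) _ = here refl
    below-b (there (here refl)) b<b = ⊥-elim (n≮n b b<b)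
    below-b (there (there (here refl))) _ = here refl
    below-b (there (there (there (here refl)))) _ = there (here refl)
    two-below-b : countBelow b u ≡ 2
    two-below-b = countBelow≡length ((<⇒≢ a<d All.∷ All.[]) ∷ All.[] ∷ []) below-b
      λ { (here refl) → here refl , a<b ; (there (here refl)) → there (there (there (here refl))) , d<b }

Avoids-111⇔NoTriple : ∀ w → Avoids w (1 ∷ 1 ∷ 1 ∷ []) ⇔ NoTriple w
Avoids-111⇔NoTriple w = mk⇔ to from
  where
  to : Avoids w (1 ∷ 1 ∷ 1 ∷ []) → NoTriple w
  to w-avoids a aaa⊆w = w-avoids aaa⊆w (standardize-aaa a)
  from : NoTriple w → Avoids w (1 ∷ 1 ∷ 1 ∷ [])
  from noTriple {u} u⊆w std≡ with a , refl ← standardize≡111⇒ u std≡ = noTriple a u⊆w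

Avoids-1212⇔NoCrossing : ∀ w → Avoids w (1 ∷ 2 ∷ 1 ∷ 2 ∷ []) ⇔ NoCrossing w
Avoids-1212⇔NoCrossing w = mk⇔ to from
  where
  to : Avoids w (1 ∷ 2 ∷ 1 ∷ 2 ∷ []) → NoCrossing w
  to w-avoids a<b abab⊆w = w-avoids abab⊆w (standardize-abab a<b)
  from : NoCrossing w → Avoids w (1 ∷ 2 ∷ 1 ∷ 2 ∷ [])
  from noCrossing {u} u⊆w std≡ with _ , _ , a<b , refl ← standardize≡1212⇒ u std≡ = noCrossing a<b u⊆w

rgfFrom-∷⁻ : ∀ {mx x xs} → T (rgfFrom mx (x ∷ xs)) → 1 ≤ x × x ≤ suc mx × T (rgfFrom (mx ⊔ x) xs)
rgfFrom-∷⁻ {mx} {x} t with 0<x , rest ← Equivalence.to T-∧ t with x<2+mx , rgf ← Equivalence.to T-∧ rest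
  = <ᵇ⇒< 0 x 0<x , ≤-pred (<ᵇ⇒< x (suc (suc mx)) x<2+mx) , rgf

rgfFrom-fresh : ∀ mx xs → T (rgfFrom (suc mx) xs) → T (rgfFrom mx (suc mx ∷ xs))
rgfFrom-fresh mx xs rgf = Equivalence.from (T-∧ {suc mx <ᵇ suc (suc mx)})
  (<⇒<ᵇ (n<1+n (suc mx)) , subst (T ∘ flip rgfFrom xs) (sym (m≤n⇒m⊔n≡n (n≤1+n mx))) rgf)

rgfFrom-old : ∀ mx {x} xs → 1 ≤ x → x ≤ mx → T (rgfFrom mx xs) → T (rgfFrom mx (x ∷ xs))
rgfFrom-old mx {x} xs 1≤x x≤mx rgf = Equivalence.from (T-∧ {0 <ᵇ x}) (<⇒<ᵇ 1≤x ,
  Equivalence.from (T-∧ {x <ᵇ suc (suc mx)})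
    (<⇒<ᵇ (s≤s (m≤n⇒m≤1+n x≤mx)) , subst (T ∘ flip rgfFrom xs) (sym (m≥n⇒m⊔n≡m x≤mx)) rgf))

rgfFrom-letters : ∀ mx w → T (rgfFrom mx w) → ∀ {x} → x ∈ w → 1 ≤ x × x ≤ mx + length w
rgfFrom-letters mx (x ∷ xs) rgf x∈ with 1≤x , x≤1+mx , rgf′ ← rgfFrom-∷⁻ {mx} {x} {xs} rgf with x∈
... | here refl = 1≤x , ≤-trans x≤1+mx 1+mx≤mx+len
  where
  1+mx≤mx+len : suc mx ≤ mx + suc (length xs)
  1+mx≤mx+len = ≤-trans (s≤s (m≤m+n mx (length xs))) (≤-reflexive (sym (+-suc mx (length xs))))
... | there y∈ = map₂ (λ y≤ → ≤-trans y≤ mx⊔x+len≤mx+len) (rgfFrom-letters (mx ⊔ x) xs rgf′ y∈)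
  where
  mx⊔x+len≤mx+len : mx ⊔ x + length xs ≤ mx + suc (length xs)
  mx⊔x+len≤mx+len = ≤-trans (+-monoˡ-≤ (length xs) (⊔-lub (n≤1+n mx) x≤1+mx)) (≤-reflexive (sym (+-suc mx (length xs))))

isRGF⇔rgfFrom0 : ∀ w → T (isRGF w) ⇔ T (rgfFrom 0 w)
isRGF⇔rgfFrom0 [] = mk⇔ _ _
isRGF⇔rgfFrom0 (zero ∷ w) = mk⇔ (λ ()) (λ ())
isRGF⇔rgfFrom0 (suc zero ∷ w) = mk⇔ (λ t → t) (λ t → t)
isRGF⇔rgfFrom0 (suc (suc x) ∷ w) = mk⇔ (λ ()) (λ ())

-- From Motzkin paths to words

-- mx is the largest letter written so far.  A D on an empty stack, which cannot occur on a Motzkin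
-- path, ends the word.
encodeFrom : ℕ → List ℕ → List Step → Word
encodeFrom mx stack [] = []
encodeFrom mx stack (U ∷ p) = suc mx ∷ encodeFrom (suc mx) (suc mx ∷ stack) p
encodeFrom mx stack (H ∷ p) = suc mx ∷ encodeFrom (suc mx) stack p
encodeFrom mx [] (D ∷ p) = []
encodeFrom mx (s ∷ stack) (D ∷ p) = s ∷ encodeFrom mx stack p

encode : List Step → Word
encode = encodeFrom 0 []

Valid : List ℕ → List Step → Set
Valid stack p = T (validFrom (length stack) p)

record Stack (mx : ℕ) (stack : List ℕ) : Set where
  field
    range : ∀ {y} → y ∈ stack → 1 ≤ y × y ≤ mx
    descending : AllPairs _>_ stack

  below : ∀ {y} → y ∈ stack → y ≤ mx
  below = proj₂ ∘ range

open Stack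

Stack-empty : Stack 0 []
Stack-empty = record { range = λ () ; descending = [] }

Stack-push : ∀ {mx stack} → Stack mx stack → Stack (suc mx) (suc mx ∷ stack)
Stack-push S = record
  { range = λ { (here refl) → s≤s z≤n , ≤-refl ; (there y∈) → map₂ m≤n⇒m≤1+n (range S y∈) }
  ; descending = All.tabulate (s≤s ∘ below S) ∷ descending S }

Stack-grow : ∀ {mx stack} → Stack mx stack → Stack (suc mx) stack
Stack-grow S = record { range = map₂ m≤n⇒m≤1+n ∘ range S ; descending = descending S }

Stack-pop : ∀ {mx s stack} → Stack mx (s ∷ stack) → Stack mx stack
Stack-pop S = record { range = range S ∘ there ; descending = AllPairs.tail (descending S) }

Stack-top : ∀ {mx s stack y} → Stack mx (s ∷ stack) → y ∈ stack → y < s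
Stack-top S y∈ with s>stack ∷ _ ← descending S = All.lookup s>stack y∈

encode-letters : ∀ mx stack p {x} → x ∈ encodeFrom mx stack p → x ∈ stack ⊎ mx < x
encode-letters mx stack (U ∷ p) (here refl) = inj₂ ≤-refl
encode-letters mx stack (U ∷ p) (there x∈) with encode-letters (suc mx) (suc mx ∷ stack) p x∈
... | inj₁ (here refl) = inj₂ ≤-refl
... | inj₁ (there x∈stack) = inj₁ x∈stack
... | inj₂ 1+mx<x = inj₂ (<-trans (n<1+n mx) 1+mx<x)
encode-letters mx stack (H ∷ p) (here refl) = inj₂ ≤-refl
encode-letters mx stack (H ∷ p) (there x∈) with encode-letters (suc mx) stack p x∈
... | inj₁ x∈stack = inj₁ x∈stack
... | inj₂ 1+mx<x = inj₂ (<-trans (n<1+n mx) 1+mx<x)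
encode-letters mx (s ∷ stack) (D ∷ p) (here refl) = inj₁ (here refl)
encode-letters mx (s ∷ stack) (D ∷ p) (there x∈) with encode-letters mx stack p x∈
... | inj₁ x∈stack = inj₁ (there x∈stack)
... | inj₂ mx<x = inj₂ mx<x

stack⊆encode : ∀ mx stack p → Valid stack p → ∀ {y} → y ∈ stack → y ∈ encodeFrom mx stack p
stack⊆encode mx (_ ∷ _) [] () _
stack⊆encode mx stack (U ∷ p) valid y∈ = there (stack⊆encode (suc mx) (suc mx ∷ stack) p valid (there y∈))
stack⊆encode mx stack (H ∷ p) valid y∈ = there (stack⊆encode (suc mx) stack p valid y∈)
stack⊆encode mx (s ∷ stack) (D ∷ p) valid (here refl) = here refl
stack⊆encode mx (s ∷ stack) (D ∷ p) valid (there y∈) = there (stack⊆encode mx stack p valid y∈)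

closed∉encode : ∀ mx stack p {a} → a ≤ mx → a ∉ stack → a ∉ encodeFrom mx stack p
closed∉encode mx stack p a≤mx a∉stack a∈ with encode-letters mx stack p a∈
... | inj₁ a∈stack = a∉stack a∈stack
... | inj₂ mx<a = <⇒≱ mx<a a≤mx

fresh∉encode : ∀ {mx stack} p → Stack mx stack → suc mx ∉ encodeFrom (suc mx) stack p
fresh∉encode p S = closed∉encode _ _ p ≤-refl (1+n≰n ∘ below S)

popped∉encode : ∀ {mx s stack} p → Stack mx (s ∷ stack) → s ∉ encodeFrom mx stack p
popped∉encode p S = closed∉encode _ _ p (below S (here refl)) (λ s∈ → n≮n _ (Stack-top S s∈))

drop-second : ∀ {A : Set} {a b : A} {cs ws} → a ∷ b ∷ cs ⊆ ws → a ∷ cs ⊆ ws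
drop-second {b = b} = ⊆-trans (refl ∷ (b ∷ʳ ⊆-refl))

encode-old-once : ∀ mx stack p → Stack mx stack → ∀ {a} → a ≤ mx → ¬ (a ∷ a ∷ [] ⊆ encodeFrom mx stack p)
encode-old-once mx stack (U ∷ p) S a≤mx (_ ∷ʳ aa⊆) = encode-old-once (suc mx) _ p (Stack-push S) (m≤n⇒m≤1+n a≤mx) aa⊆
encode-old-once mx stack (U ∷ p) S a≤mx (refl ∷ _) = 1+n≰n a≤mx
encode-old-once mx stack (H ∷ p) S a≤mx (_ ∷ʳ aa⊆) = encode-old-once (suc mx) _ p (Stack-grow S) (m≤n⇒m≤1+n a≤mx) aa⊆
encode-old-once mx stack (H ∷ p) S a≤mx (refl ∷ _) = 1+n≰n a≤mx
encode-old-once mx (s ∷ stack) (D ∷ p) S a≤mx (_ ∷ʳ aa⊆) = encode-old-once mx stack p (Stack-pop S) a≤mx aa⊆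
encode-old-once mx (s ∷ stack) (D ∷ p) S a≤mx (refl ∷ a⊆) = popped∉encode p S (lookup a⊆ (here refl))

encode-noTriple : ∀ mx stack p → Stack mx stack → NoTriple (encodeFrom mx stack p)
encode-noTriple mx stack (U ∷ p) S a (_ ∷ʳ aaa⊆) = encode-noTriple (suc mx) _ p (Stack-push S) a aaa⊆
encode-noTriple mx stack (U ∷ p) S a (refl ∷ aa⊆) = encode-old-once (suc mx) _ p (Stack-push S) ≤-refl aa⊆
encode-noTriple mx stack (H ∷ p) S a (_ ∷ʳ aaa⊆) = encode-noTriple (suc mx) _ p (Stack-grow S) a aaa⊆
encode-noTriple mx stack (H ∷ p) S a (refl ∷ aa⊆) = encode-old-once (suc mx) _ p (Stack-grow S) ≤-refl aa⊆
encode-noTriple mx (s ∷ stack) (D ∷ p) S a (_ ∷ʳ aaa⊆) = encode-noTriple mx stack p (Stack-pop S) a aaa⊆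
encode-noTriple mx (s ∷ stack) (D ∷ p) S a (refl ∷ aa⊆) = encode-old-once mx stack p (Stack-pop S) (below S (here refl)) aa⊆

encode-pops-in-order : ∀ mx stack p → Stack mx stack → ∀ {a c} → a ∈ stack → c ∈ stack → a < c →
                       ¬ (a ∷ c ∷ [] ⊆ encodeFrom mx stack p)
encode-pops-in-order mx stack (U ∷ p) S a∈ c∈ a<c (_ ∷ʳ ac⊆) =
  encode-pops-in-order (suc mx) _ p (Stack-push S) (there a∈) (there c∈) a<c ac⊆
encode-pops-in-order mx stack (U ∷ p) S a∈ c∈ a<c (refl ∷ _) = 1+n≰n (below S a∈)
encode-pops-in-order mx stack (H ∷ p) S a∈ c∈ a<c (_ ∷ʳ ac⊆) =
  encode-pops-in-order (suc mx) _ p (Stack-grow S) a∈ c∈ a<c ac⊆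
encode-pops-in-order mx stack (H ∷ p) S a∈ c∈ a<c (refl ∷ _) = 1+n≰n (below S a∈)
encode-pops-in-order mx (s ∷ stack) (D ∷ p) S (here refl) (here refl) a<c _ = n≮n s a<c
encode-pops-in-order mx (s ∷ stack) (D ∷ p) S (here refl) (there c∈) a<c _ = <-asym a<c (Stack-top S c∈)
encode-pops-in-order mx (s ∷ stack) (D ∷ p) S (there a∈) c∈ a<c (refl ∷ _) = n≮n _ (Stack-top S a∈)
encode-pops-in-order mx (s ∷ stack) (D ∷ p) S (there a∈) (here refl) a<c (_ ∷ʳ ac⊆) =
  popped∉encode p S (lookup ac⊆ (there (here refl)))
encode-pops-in-order mx (s ∷ stack) (D ∷ p) S (there a∈) (there c∈) a<c (_ ∷ʳ ac⊆) =
  encode-pops-in-order mx stack p (Stack-pop S) a∈ c∈ a<c ac⊆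

encode-no-fresh-around-open : ∀ mx stack p → Stack mx stack → ∀ {a c} → a ∈ stack → mx < c →
                              ¬ (c ∷ a ∷ c ∷ [] ⊆ encodeFrom mx stack p)
encode-no-fresh-around-open mx stack (U ∷ p) S {c = c} a∈ mx<c (_ ∷ʳ cac⊆) with c ≟ suc mx
... | yes refl = encode-old-once (suc mx) _ p (Stack-push S) ≤-refl (drop-second cac⊆)
... | no c≢1+mx = encode-no-fresh-around-open (suc mx) _ p (Stack-push S) (there a∈) (≤∧≢⇒< mx<c (c≢1+mx ∘ sym)) cac⊆
encode-no-fresh-around-open mx stack (U ∷ p) S a∈ mx<c (refl ∷ ac⊆) =
  encode-pops-in-order (suc mx) _ p (Stack-push S) (there a∈) (here refl) (s≤s (below S a∈)) ac⊆
encode-no-fresh-around-open mx stack (H ∷ p) S {c = c} a∈ mx<c (_ ∷ʳ cac⊆) with c ≟ suc mx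
... | yes refl = encode-old-once (suc mx) _ p (Stack-grow S) ≤-refl (drop-second cac⊆)
... | no c≢1+mx = encode-no-fresh-around-open (suc mx) _ p (Stack-grow S) a∈ (≤∧≢⇒< mx<c (c≢1+mx ∘ sym)) cac⊆
encode-no-fresh-around-open mx stack (H ∷ p) S a∈ mx<c (refl ∷ ac⊆) = fresh∉encode p S (lookup ac⊆ (there (here refl)))
encode-no-fresh-around-open mx (s ∷ stack) (D ∷ p) S (here refl) mx<c (_ ∷ʳ cac⊆) =
  popped∉encode p S (lookup cac⊆ (there (here refl)))
encode-no-fresh-around-open mx (s ∷ stack) (D ∷ p) S (there a∈) mx<c (_ ∷ʳ cac⊆) =
  encode-no-fresh-around-open mx stack p (Stack-pop S) a∈ mx<c cac⊆
encode-no-fresh-around-open mx (s ∷ stack) (D ∷ p) S a∈ mx<c (refl ∷ _) = <⇒≱ mx<c (below S (here refl))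

encode-noCrossing : ∀ mx stack p → Stack mx stack → NoCrossing (encodeFrom mx stack p)
encode-noCrossing mx stack (U ∷ p) S a<c (_ ∷ʳ acac⊆) = encode-noCrossing (suc mx) _ p (Stack-push S) a<c acac⊆
encode-noCrossing mx stack (U ∷ p) S a<c (refl ∷ cac⊆) =
  encode-no-fresh-around-open (suc mx) _ p (Stack-push S) (here refl) a<c cac⊆
encode-noCrossing mx stack (H ∷ p) S a<c (_ ∷ʳ acac⊆) = encode-noCrossing (suc mx) _ p (Stack-grow S) a<c acac⊆
encode-noCrossing mx stack (H ∷ p) S a<c (refl ∷ cac⊆) = fresh∉encode p S (lookup cac⊆ (there (here refl)))
encode-noCrossing mx (s ∷ stack) (D ∷ p) S a<c (_ ∷ʳ acac⊆) = encode-noCrossing mx stack p (Stack-pop S) a<c acac⊆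
encode-noCrossing mx (s ∷ stack) (D ∷ p) S a<c (refl ∷ cac⊆) = popped∉encode p S (lookup cac⊆ (there (here refl)))

encode-rgf : ∀ mx stack p → Stack mx stack → T (rgfFrom mx (encodeFrom mx stack p))
encode-rgf mx stack [] S = _
encode-rgf mx stack (U ∷ p) S = rgfFrom-fresh mx (encodeFrom (suc mx) (suc mx ∷ stack) p) (encode-rgf (suc mx) _ p (Stack-push S))
encode-rgf mx stack (H ∷ p) S = rgfFrom-fresh mx (encodeFrom (suc mx) stack p) (encode-rgf (suc mx) _ p (Stack-grow S))
encode-rgf mx [] (D ∷ p) S = _
encode-rgf mx (s ∷ stack) (D ∷ p) S =
  rgfFrom-old mx (encodeFrom mx stack p) (proj₁ (range S (here refl))) (below S (here refl)) (encode-rgf mx stack p (Stack-pop S))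

encode-length : ∀ mx stack p → Valid stack p → length (encodeFrom mx stack p) ≡ length p
encode-length mx stack [] valid = refl
encode-length mx stack (U ∷ p) valid = cong suc (encode-length (suc mx) _ p valid)
encode-length mx stack (H ∷ p) valid = cong suc (encode-length (suc mx) _ p valid)
encode-length mx (s ∷ stack) (D ∷ p) valid = cong suc (encode-length mx stack p valid)

-- The letters below c that occur later are exactly the open ones below c: the closed ones never
-- reappear and the fresh ones are at least c.
countBelow-encode : ∀ {mx stack′ c} stack p → Stack mx stack′ → Valid stack′ p → c ≤ suc mx →
  Unique stack → (∀ {y} → y ∈ stack′ → y < c → y ∈ stack) → (∀ {y} → y ∈ stack → y ∈ stack′ × y < c) →
  countBelow c (encodeFrom mx stack′ p) ≡ length stack
countBelow-encode {mx} {stack′} {c} stack p S valid c≤1+mx u below⇒stack stack⇒below =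
  countBelow≡length u written-below (λ y∈ → map₁ (stack⊆encode mx stack′ p valid) (stack⇒below y∈))
  where
  written-below : ∀ {y} → y ∈ encodeFrom mx stack′ p → y < c → y ∈ stack
  written-below y∈ y<c with encode-letters mx stack′ p y∈
  ... | inj₁ y∈stack′ = below⇒stack y∈stack′ y<c
  ... | inj₂ mx<y = ⊥-elim (<⇒≱ y<c (≤-trans c≤1+mx mx<y))

Stack-unique : ∀ {mx stack} → Stack mx stack → Unique stack
Stack-unique S = AllPairs.map >⇒≢ (descending S)

rs-encode : ∀ mx stack p → Stack mx stack → Valid stack p → rs (encodeFrom mx stack p) ≡ levelFrom (length stack) p
rs-encode mx stack [] S valid = refl
rs-encode mx stack (U ∷ p) S valid = cong₂ _+_
  (countBelow-encode stack p (Stack-push S) valid (n≤1+n _) (Stack-unique S)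
    (λ { (here refl) 1+mx<1+mx → ⊥-elim (n≮n _ 1+mx<1+mx) ; (there y∈) _ → y∈ })
    (λ y∈ → there y∈ , s≤s (below S y∈)))
  (rs-encode (suc mx) _ p (Stack-push S) valid)
rs-encode mx stack (H ∷ p) S valid = cong₂ _+_
  (countBelow-encode stack p (Stack-grow S) valid (n≤1+n _) (Stack-unique S) (λ y∈ _ → y∈) (λ y∈ → y∈ , s≤s (below S y∈)))
  (rs-encode (suc mx) _ p (Stack-grow S) valid)
rs-encode mx (s ∷ stack) (D ∷ p) S valid = cong₂ _+_
  (countBelow-encode stack p (Stack-pop S) valid (m≤n⇒m≤1+n (below S (here refl))) (Stack-unique (Stack-pop S))
    (λ y∈ _ → y∈) (λ y∈ → y∈ , Stack-top S y∈))
  (rs-encode mx stack p (Stack-pop S) valid)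

-- From words to Motzkin paths

decodeFrom : ℕ → Word → List Step
decodeFrom mx [] = []
decodeFrom mx (x ∷ xs) with x ≤? mx | x ∈? xs
... | yes _ | _ = D ∷ decodeFrom mx xs
... | no _ | yes _ = U ∷ decodeFrom x xs
... | no _ | no _ = H ∷ decodeFrom x xs

decode : Word → List Step
decode = decodeFrom 0

decode-encode : ∀ mx stack p → Stack mx stack → Valid stack p → decodeFrom mx (encodeFrom mx stack p) ≡ p
decode-encode mx stack [] S valid = refl
decode-encode mx stack (U ∷ p) S valid
  with suc mx ≤? mx | suc mx ∈? encodeFrom (suc mx) (suc mx ∷ stack) p
... | yes 1+mx≤mx | _ = ⊥-elim (1+n≰n 1+mx≤mx)
... | no _ | yes _ = cong (U ∷_) (decode-encode (suc mx) _ p (Stack-push S) valid)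
... | no _ | no 1+mx∉ = ⊥-elim (1+mx∉ (stack⊆encode (suc mx) _ p valid (here refl)))
decode-encode mx stack (H ∷ p) S valid
  with suc mx ≤? mx | suc mx ∈? encodeFrom (suc mx) stack p
... | yes 1+mx≤mx | _ = ⊥-elim (1+n≰n 1+mx≤mx)
... | no _ | yes 1+mx∈ = ⊥-elim (fresh∉encode p S 1+mx∈)
... | no _ | no _ = cong (H ∷_) (decode-encode (suc mx) _ p (Stack-grow S) valid)
decode-encode mx (s ∷ stack) (D ∷ p) S valid with s ≤? mx
... | yes _ = cong (D ∷_) (decode-encode mx stack p (Stack-pop S) valid)
... | no s≰mx = ⊥-elim (s≰mx (below S (here refl)))

record Prefix (pre : Word) (mx : ℕ) : Set where
  field
    complete : ∀ {y} → 1 ≤ y → y ≤ mx → y ∈ pre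
    bounded : ∀ {y} → y ∈ pre → y ≤ mx
    ordered : ∀ {a b} → 1 ≤ a → a < b → b ∈ pre → a ∷ b ∷ [] ⊆ pre

module _ {pre mx} (P : Prefix pre mx) where
  open Prefix P

  private
    ordered-snoc : ∀ {x} → x ≤ suc mx → ∀ {a b} → 1 ≤ a → a < b → b ∈ pre ++ [ x ] → a ∷ b ∷ [] ⊆ pre ++ [ x ]
    ordered-snoc {x} x≤1+mx 1≤a a<b b∈ with ∈-++⁻ pre b∈
    ... | inj₁ b∈pre = ++⁺ʳ [ x ] (ordered 1≤a a<b b∈pre)
    ... | inj₂ (here refl) = ++⁺ (from∈ (complete 1≤a (≤-pred (≤-trans a<b x≤1+mx)))) (refl ∷ [])

  Prefix-old : ∀ {x} → x ≤ mx → Prefix (pre ++ [ x ]) mx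
  Prefix-old {x} x≤mx = record
    { complete = λ 1≤y y≤mx → ∈-++⁺ˡ (complete 1≤y y≤mx)
    ; bounded = λ y∈ → [ bounded , (λ { (here refl) → x≤mx }) ]′ (∈-++⁻ pre y∈)
    ; ordered = ordered-snoc (m≤n⇒m≤1+n x≤mx) }

  Prefix-fresh : Prefix (pre ++ [ suc mx ]) (suc mx)
  Prefix-fresh = record
    { complete = complete′
    ; bounded = λ y∈ → [ m≤n⇒m≤1+n ∘ bounded , (λ { (here refl) → ≤-refl }) ]′ (∈-++⁻ pre y∈)
    ; ordered = ordered-snoc ≤-refl }
    where
    complete′ : ∀ {y} → 1 ≤ y → y ≤ suc mx → y ∈ pre ++ [ suc mx ]
    complete′ {y} 1≤y y≤1+mx with y ≤? mx
    ... | yes y≤mx = ∈-++⁺ˡ (complete 1≤y y≤mx)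
    ... | no y≰mx rewrite ≤-antisym y≤1+mx (≰⇒> y≰mx) = ∈-++⁺ʳ pre (here refl)

Prefix-empty : Prefix [] 0
Prefix-empty = record { complete = λ 1≤y y≤0 → ⊥-elim (<⇒≱ 1≤y y≤0) ; bounded = λ () ; ordered = λ _ _ () }

module Decoding (w : Word) (noTriple : NoTriple w) (noCrossing : NoCrossing w) where

  record Scan (pre : Word) (mx : ℕ) (stack : List ℕ) (rest : Word) : Set where
    field
      splits : pre ++ rest ≡ w
      prefix : Prefix pre mx
      descending : AllPairs _>_ stack
      open⇒seen×pending : ∀ {y} → y ∈ stack → y ∈ pre × y ∈ rest
      seen×pending⇒open : ∀ {y} → y ∈ pre → y ∈ rest → y ∈ stack

  open Scan

  private
    no-third-occurrence : ∀ {pre x xs} → pre ++ x ∷ xs ≡ w → x ∈ pre → x ∉ xs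
    no-third-occurrence {pre} splits x∈pre x∈xs =
      noTriple _ (subst (_ ⊆_) splits (++⁺ (from∈ x∈pre) (refl ∷ from∈ x∈xs)))

    splits-snoc : ∀ {pre x xs} → pre ++ x ∷ xs ≡ w → (pre ++ [ x ]) ++ xs ≡ w
    splits-snoc {pre} {x} {xs} = trans (++-assoc pre [ x ] xs)

  scan-done : ∀ {pre mx stack} → Scan pre mx stack [] → stack ≡ []
  scan-done {stack = []} _ = refl
  scan-done {stack = _ ∷ _} σ with () ← proj₂ (open⇒seen×pending σ (here refl))

  -- An old letter x must be the top of the stack: if it lay deeper, below the top s, then x s x s
  -- would be a crossing, since x first occurs before s.
  scan-old : ∀ {pre mx stack x xs} → Scan pre mx stack (x ∷ xs) → 1 ≤ x → x ≤ mx →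
             ∃ λ stack₀ → stack ≡ x ∷ stack₀ × Scan (pre ++ [ x ]) mx stack₀ xs
  scan-old {pre} {mx} {stack} {x} {xs} σ 1≤x x≤mx
    with seen×pending⇒open σ (Prefix.complete (prefix σ) 1≤x x≤mx) (here refl)
  ... | here refl = _ , refl , record
    { splits = splits-snoc (splits σ)
    ; prefix = Prefix-old (prefix σ) x≤mx
    ; descending = AllPairs.tail (descending σ)
    ; open⇒seen×pending = open⇒
    ; seen×pending⇒open = ⇒open }
    where
    x∈pre = Prefix.complete (prefix σ) 1≤x x≤mx
    open⇒ : ∀ {y} → y ∈ _ → y ∈ pre ++ [ x ] × y ∈ xs
    open⇒ y∈ with open⇒seen×pending σ (there y∈) | descending σ
    ... | y∈pre , here refl | x>stack₀ ∷ _ = ⊥-elim (n≮n x (All.lookup x>stack₀ y∈))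
    ... | y∈pre , there y∈xs | _ = ∈-++⁺ˡ y∈pre , y∈xs
    ⇒open : ∀ {y} → y ∈ pre ++ [ x ] → y ∈ xs → y ∈ _
    ⇒open y∈ y∈xs with ∈-++⁻ pre y∈
    ... | inj₂ (here refl) = ⊥-elim (no-third-occurrence (splits σ) x∈pre y∈xs)
    ... | inj₁ y∈pre with seen×pending⇒open σ y∈pre (there y∈xs)
    ...   | here refl = ⊥-elim (no-third-occurrence (splits σ) x∈pre y∈xs)
    ...   | there y∈stack₀ = y∈stack₀
  ... | there x∈stack₀ with s>stack₀ ∷ _ ← descending σ
    = ⊥-elim (noCrossing x<s (subst (_ ⊆_) (splits σ) (++⁺ (Prefix.ordered (prefix σ) 1≤x x<s s∈pre) (refl ∷ from∈ s∈xs))))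
    where
    x<s = All.lookup s>stack₀ x∈stack₀
    s∈pre = proj₁ (open⇒seen×pending σ (here refl))
    s∈xs : _ ∈ xs
    s∈xs with proj₂ (open⇒seen×pending σ (here refl))
    ... | here refl = ⊥-elim (n≮n x x<s)
    ... | there s∈xs = s∈xs

  private
    open-pending : ∀ {pre mx stack xs} → Scan pre mx stack (suc mx ∷ xs) → ∀ {y} → y ∈ stack → y ∈ xs
    open-pending σ y∈ with open⇒seen×pending σ y∈
    ... | y∈pre , here refl = ⊥-elim (1+n≰n (Prefix.bounded (prefix σ) y∈pre))
    ... | _ , there y∈xs = y∈xs

  scan-fresh-open : ∀ {pre mx stack xs} → Scan pre mx stack (suc mx ∷ xs) → suc mx ∈ xs →
                    Scan (pre ++ [ suc mx ]) (suc mx) (suc mx ∷ stack) xs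
  scan-fresh-open {pre} {mx} {stack} {xs} σ 1+mx∈xs = record
    { splits = splits-snoc (splits σ)
    ; prefix = Prefix-fresh (prefix σ)
    ; descending = All.tabulate (s≤s ∘ Prefix.bounded (prefix σ) ∘ proj₁ ∘ open⇒seen×pending σ) ∷ descending σ
    ; open⇒seen×pending = λ { (here refl) → ∈-++⁺ʳ pre (here refl) , 1+mx∈xs
                            ; (there y∈) → ∈-++⁺ˡ (proj₁ (open⇒seen×pending σ y∈)) , open-pending σ y∈ }
    ; seen×pending⇒open = ⇒open }
    where
    ⇒open : ∀ {y} → y ∈ pre ++ [ suc mx ] → y ∈ xs → y ∈ suc mx ∷ stack
    ⇒open y∈ y∈xs with ∈-++⁻ pre y∈
    ... | inj₁ y∈pre = there (seen×pending⇒open σ y∈pre (there y∈xs))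
    ... | inj₂ (here refl) = here refl

  scan-fresh-single : ∀ {pre mx stack xs} → Scan pre mx stack (suc mx ∷ xs) → suc mx ∉ xs →
                      Scan (pre ++ [ suc mx ]) (suc mx) stack xs
  scan-fresh-single {pre} {mx} {stack} {xs} σ 1+mx∉xs = record
    { splits = splits-snoc (splits σ)
    ; prefix = Prefix-fresh (prefix σ)
    ; descending = descending σ
    ; open⇒seen×pending = λ y∈ → ∈-++⁺ˡ (proj₁ (open⇒seen×pending σ y∈)) , open-pending σ y∈
    ; seen×pending⇒open = ⇒open }
    where
    ⇒open : ∀ {y} → y ∈ pre ++ [ suc mx ] → y ∈ xs → y ∈ stack
    ⇒open y∈ y∈xs with ∈-++⁻ pre y∈
    ... | inj₁ y∈pre = seen×pending⇒open σ y∈pre (there y∈xs)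
    ... | inj₂ (here refl) = ⊥-elim (1+mx∉xs y∈xs)

  encode-decode : ∀ {pre mx stack} rest → Scan pre mx stack rest → T (rgfFrom mx rest) →
                  Valid stack (decodeFrom mx rest) × encodeFrom mx stack (decodeFrom mx rest) ≡ rest
  encode-decode [] σ _ rewrite scan-done σ = _ , refl
  encode-decode {mx = mx} (x ∷ xs) σ rgf with 1≤x , x≤1+mx , rgf′ ← rgfFrom-∷⁻ {mx} {x} {xs} rgf
    with x ≤? mx | x ∈? xs
  ... | yes x≤mx | _ with _ , refl , σ′ ← scan-old σ 1≤x x≤mx =
    map₂ (cong (x ∷_)) (encode-decode xs σ′ (subst (T ∘ flip rgfFrom xs) (m≥n⇒m⊔n≡m x≤mx) rgf′))
  ... | no x≰mx | yes x∈xs with refl ← ≤-antisym x≤1+mx (≰⇒> x≰mx) =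
    map₂ (cong (x ∷_)) (encode-decode xs (scan-fresh-open σ x∈xs) (subst (T ∘ flip rgfFrom xs) (m≤n⇒m⊔n≡n (n≤1+n mx)) rgf′))
  ... | no x≰mx | no x∉xs with refl ← ≤-antisym x≤1+mx (≰⇒> x≰mx) =
    map₂ (cong (x ∷_)) (encode-decode xs (scan-fresh-single σ x∉xs) (subst (T ∘ flip rgfFrom xs) (m≤n⇒m⊔n≡n (n≤1+n mx)) rgf′))

  scan-start : Scan [] 0 [] w
  scan-start = record
    { splits = refl ; prefix = Prefix-empty ; descending = []
    ; open⇒seen×pending = λ () ; seen×pending⇒open = λ () }

  encode∘decode : T (rgfFrom 0 w) → Valid [] (decode w) × encode (decode w) ≡ w
  encode∘decode = encode-decode w scan-start

record MotzkinPath (n : ℕ) (p : List Step) : Set where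
  constructor motzkinPath
  field
    length≡ : length p ≡ n
    valid : Valid [] p

record AvoidingRGF (n : ℕ) (w : Word) : Set where
  constructor avoidingRGF
  field
    length≡ : length w ≡ n
    rgf : T (rgfFrom 0 w)
    noTriple : NoTriple w
    noCrossing : NoCrossing w

∈-M⁻ : ∀ n {p} → p ∈ M n → MotzkinPath n p
∈-M⁻ n p∈ with p∈paths , valid ← ∈-keep⁻ (validFrom 0) (allPaths n) p∈ = motzkinPath (allPaths-length n p∈paths) valid

∈-M⁺ : ∀ n {p} → MotzkinPath n p → p ∈ M n
∈-M⁺ n {p} (motzkinPath refl valid) = ∈-keep⁺ (validFrom 0) (allPaths n) (∈-allPaths p) valid

∈-Ravoid⁻ : ∀ n {w} → w ∈ Ravoid n (1 ∷ 1 ∷ 1 ∷ []) (1 ∷ 2 ∷ 1 ∷ 2 ∷ []) → AvoidingRGF n w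
∈-Ravoid⁻ n {w} w∈
  with w∈R , avoids-both ← ∈-keep⁻ _ (R n) w∈
  with w∈words , rgf ← ∈-keep⁻ isRGF (allWords n n) w∈R
  with avoids-111 , avoids-1212 ← Equivalence.to T-∧ avoids-both
  = avoidingRGF (allWords-length n n w∈words)
      (Equivalence.to (isRGF⇔rgfFrom0 w) rgf)
      (Equivalence.to (Avoids-111⇔NoTriple w) (avoids⇒Avoids w _ avoids-111))
      (Equivalence.to (Avoids-1212⇔NoCrossing w) (avoids⇒Avoids w _ avoids-1212))

∈-Ravoid⁺ : ∀ n {w} → AvoidingRGF n w → w ∈ Ravoid n (1 ∷ 1 ∷ 1 ∷ []) (1 ∷ 2 ∷ 1 ∷ 2 ∷ [])
∈-Ravoid⁺ n {w} (avoidingRGF refl rgf noTriple noCrossing) =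
  ∈-keep⁺ _ (R n) (∈-keep⁺ isRGF (allWords n n) (∈-allWords n w (rgfFrom-letters 0 w rgf)) (Equivalence.from (isRGF⇔rgfFrom0 w) rgf))
    (Equivalence.from T-∧
      ( Avoids⇒avoids w _ (Equivalence.from (Avoids-111⇔NoTriple w) noTriple)
      , Avoids⇒avoids w _ (Equivalence.from (Avoids-1212⇔NoCrossing w) noCrossing)))

encode-avoiding : ∀ {n p} → MotzkinPath n p → AvoidingRGF n (encode p)
encode-avoiding {n} {p} (motzkinPath length≡n valid) = avoidingRGF
  (trans (encode-length 0 [] p valid) length≡n) (encode-rgf 0 [] p Stack-empty)
  (encode-noTriple 0 [] p Stack-empty) (encode-noCrossing 0 [] p Stack-empty)

decode∘encode : ∀ {n p} → MotzkinPath n p → decode (encode p) ≡ p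
decode∘encode {p = p} (motzkinPath _ valid) = decode-encode 0 [] p Stack-empty valid

rs∘encode≡level : ∀ {n p} → MotzkinPath n p → rs (encode p) ≡ level p
rs∘encode≡level {p = p} (motzkinPath _ valid) = rs-encode 0 [] p Stack-empty valid

decode-motzkin : ∀ {n w} → AvoidingRGF n w → MotzkinPath n (decode w) × encode (decode w) ≡ w
decode-motzkin {n} {w} (avoidingRGF length≡n rgf noTriple noCrossing)
  with valid , encode∘decode ← Decoding.encode∘decode w noTriple noCrossing rgf
  = motzkinPath (trans (sym (encode-length 0 [] (decode w) valid)) (trans (cong length encode∘decode) length≡n)) valid
  , encode∘decode

theorem5p10 : (n k : ℕ) →
    RS n (1 ∷ 1 ∷ 1 ∷ []) (1 ∷ 2 ∷ 1 ∷ 2 ∷ []) k ≡ genPoly (M n) level k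
theorem5p10 n k = sym (genPoly-≡-by-inverses level rs encode decode
  (∈-Ravoid⁺ n ∘ encode-avoiding ∘ ∈-M⁻ n)
  (∈-M⁺ n ∘ proj₁ ∘ decode-motzkin ∘ ∈-Ravoid⁻ n)
  (decode∘encode ∘ ∈-M⁻ n)
  (proj₂ ∘ decode-motzkin ∘ ∈-Ravoid⁻ n)
  (rs∘encode≡level ∘ ∈-M⁻ n)
  (keep-unique _ (allPaths-unique n))
  (keep-unique _ (keep-unique _ (allWords-unique n n)))
  k)
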